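{- For any two integers $a,b\ge 3$ there exist a graph $G$ and an induced subgraph $H$ of $G$ such that $\gamma^{p}_{I}(G)=a$ and $\gamma^{p}_{I}(H)=b$.
   Context: All graphs are finite and simple. A perfect Italian dominating function (PID-function) of a graph $G$ is a function $f:V(G)\to\{0,1,2\}$ such that for every vertex $v$ with $f(v)=0$ we have $\sum_{u\in N(v)}f(u)=2$, where $N(v)$ is the open neighborhood of $v$. Its weight is $\sum_{u\in V(G)}f(u)$. The perfect Italian domination number $\gamma^{p}_{I}(G)$ is the minimum weight of a PID-function of $G$. -}

module Defs where

open import Data.Nat using (ℕ; _≤_)
open import Data.Bool using (Bool; true; false; if_then_else_)
open import Data.Fin using (Fin; toℕ)
open import Data.List using (map; allFin)
open import Data.Nat.ListAction using (sum)
open import Data.Product using (Σ; _×_; ∃)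
open import Relation.Binary.PropositionalEquality using (_≡_)
open import Function.Definitions using (Injective)

record Graph : Set where
  field
    n     : ℕ
    adj   : Fin n → Fin n → Bool
    sym   : ∀ u v → adj u v ≡ adj v u
    irrefl : ∀ v → adj v v ≡ false
open Graph public

Σᵥ : (m : ℕ) → (Fin m → ℕ) → ℕ
Σᵥ m g = sum (map g (allFin m))

Labelling : Graph → Set
Labelling G = Fin (n G) → Fin 3

val : ∀ {G} → Labelling G → Fin (n G) → ℕ
val f v = toℕ (f v)

nbSum : (G : Graph) → Labelling G → Fin (n G) → ℕ
nbSum G f v = Σᵥ (n G) (λ u → if adj G v u then val {G} f u else 0)

weight : (G : Graph) → Labelling G → ℕ
weight G f = Σᵥ (n G) (val {G} f)

IsPID : (G : Graph) → Labelling G → Set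
IsPID G f = ∀ v → val {G} f v ≡ 0 → nbSum G f v ≡ 2

PIDNumber : Graph → ℕ → Set
PIDNumber G k =
  Σ (Labelling G) (λ f → IsPID G f × weight G f ≡ k)
  × (∀ f → IsPID G f → k ≤ weight G f)

IsInducedSubgraph : Graph → Graph → Set
IsInducedSubgraph H G =
  Σ (Fin (n H) → Fin (n G)) (λ ι →
    Injective _≡_ _≡_ ι × (∀ u v → adj G (ι u) (ι v) ≡ adj H u v))

module Submission where

-- Witnesses: G = K₁,b ⊕ Ē(a ∸ 2), the disjoint union of the star with b
-- leaves and the edgeless graph on a ∸ 2 vertices, and H = Ē(b), the set of
-- leaves of the star, which is induced in K₁,b and hence in G.

open import Defs hiding (sym)
open import Data.Nat using (ℕ; zero; suc; _+_; _≤_; z≤n; s≤s)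
open import Data.Nat.Properties using (+-assoc; +-identityʳ; +-mono-≤; ≤-reflexive; ≤-trans; m≤m+n)
open import Data.Bool using (Bool; true; false; if_then_else_)
open import Data.Fin using (Fin; zero; suc; toℕ; _↑ˡ_; _↑ʳ_; splitAt)
open import Data.Fin.Properties
  using (suc-injective; ↑ˡ-injective; splitAt-↑ˡ; splitAt-↑ʳ; splitAt⁻¹-↑ˡ; splitAt⁻¹-↑ʳ)
open import Data.List.Properties using (map-tabulate)
open import Data.Nat.ListAction using (sum)
open import Data.Vec.Functional using (_++_)
open import Data.Vec.Functional.Properties using (lookup-++ˡ; lookup-++ʳ)
open import Data.Product using (Σ; _×_; _,_)
open import Data.Sum using (_⊎_; inj₁; inj₂)
open import Data.Empty using (⊥-elim)
open import Function using (_∘_)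
open import Relation.Nullary using (¬_)
open import Relation.Binary.PropositionalEquality
  using (_≡_; _≢_; _≗_; refl; sym; trans; cong; cong₂; subst)

Σᵥ-suc : ∀ m (g : Fin (suc m) → ℕ) → Σᵥ (suc m) g ≡ g zero + Σᵥ m (g ∘ suc)
Σᵥ-suc m g = cong (λ xs → g zero + sum xs)
  (trans (map-tabulate suc g) (sym (map-tabulate (λ i → i) (g ∘ suc))))

Σᵥ-cong : ∀ m {g h : Fin m → ℕ} → g ≗ h → Σᵥ m g ≡ Σᵥ m h
Σᵥ-cong zero    g≗h = refl
Σᵥ-cong (suc m) {g} {h} g≗h = trans (Σᵥ-suc m g)
  (trans (cong₂ _+_ (g≗h zero) (Σᵥ-cong m (g≗h ∘ suc))) (sym (Σᵥ-suc m h)))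

Σᵥ-zero : ∀ m (g : Fin m → ℕ) → (∀ i → g i ≡ 0) → Σᵥ m g ≡ 0
Σᵥ-zero zero    g g≡0 = refl
Σᵥ-zero (suc m) g g≡0 = trans (Σᵥ-suc m g)
  (cong₂ _+_ (g≡0 zero) (Σᵥ-zero m (g ∘ suc) (g≡0 ∘ suc)))

Σᵥ-ones : ∀ m → Σᵥ m (λ _ → 1) ≡ m
Σᵥ-ones zero    = refl
Σᵥ-ones (suc m) = trans (Σᵥ-suc m (λ _ → 1)) (cong suc (Σᵥ-ones m))

Σᵥ-positive : ∀ m (g : Fin m → ℕ) → (∀ i → 1 ≤ g i) → m ≤ Σᵥ m g
Σᵥ-positive zero    g g≥1 = z≤n
Σᵥ-positive (suc m) g g≥1 = subst (suc m ≤_) (sym (Σᵥ-suc m g))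
  (+-mono-≤ (g≥1 zero) (Σᵥ-positive m (g ∘ suc) (g≥1 ∘ suc)))

Σᵥ-split : ∀ m n (g : Fin (m + n) → ℕ) →
  Σᵥ (m + n) g ≡ Σᵥ m (g ∘ (_↑ˡ n)) + Σᵥ n (g ∘ (m ↑ʳ_))
Σᵥ-split zero    n g = refl
Σᵥ-split (suc m) n g = trans (Σᵥ-suc (m + n) g)
  (trans (cong (g zero +_) (Σᵥ-split m n (g ∘ suc)))
  (trans (sym (+-assoc (g zero) _ _))
         (cong (_+ Σᵥ n (g ∘ (suc m ↑ʳ_))) (sym (Σᵥ-suc m (g ∘ (_↑ˡ n)))))))

nbSum-cong : ∀ G {f g : Labelling G} → f ≗ g → ∀ v → nbSum G f v ≡ nbSum G g v
nbSum-cong G f≗g v =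
  Σᵥ-cong (n G) (λ u → cong (λ x → if adj G v u then toℕ x else 0) (f≗g u))

weight-cong : ∀ G {f g : Labelling G} → f ≗ g → weight G f ≡ weight G g
weight-cong G f≗g = Σᵥ-cong (n G) (cong toℕ ∘ f≗g)

IsPID-cong : ∀ G {f g : Labelling G} → f ≗ g → IsPID G f → IsPID G g
IsPID-cong G f≗g pid v gv≡0 = trans (sym (nbSum-cong G f≗g v))
  (pid v (trans (cong toℕ (f≗g v)) gv≡0))

positive-label : ∀ G (f : Labelling G) → IsPID G f →
  ∀ v → nbSum G f v ≢ 2 → 1 ≤ val {G} f v
positive-label G f pid v nb≢2 with val {G} f v in fv
... | zero  = ⊥-elim (nb≢2 (pid v fv))
... | suc _ = s≤s z≤n

induced-trans : ∀ {A B C} → IsInducedSubgraph A B → IsInducedSubgraph B C →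
  IsInducedSubgraph A C
induced-trans (ι , ι-inj , ι-adj) (κ , κ-inj , κ-adj) =
  κ ∘ ι , ι-inj ∘ κ-inj , λ u v → trans (κ-adj (ι u) (ι v)) (ι-adj u v)

Edgeless : ℕ → Graph
Edgeless m = record
  { n = m ; adj = λ _ _ → false ; sym = λ _ _ → refl ; irrefl = λ _ → refl }

-- Every vertex is isolated, so every vertex needs a positive label.
Edgeless-PIDNumber : ∀ m → PIDNumber (Edgeless m) m
Edgeless-PIDNumber m = (all-one , (λ v ()) , Σᵥ-ones m) , minimal
  where
  all-one : Labelling (Edgeless m)
  all-one _ = suc zero

  isolated : ∀ f v → nbSum (Edgeless m) f v ≡ 0
  isolated f v = Σᵥ-zero m _ (λ _ → refl)

  minimal : ∀ f → IsPID (Edgeless m) f → m ≤ weight (Edgeless m) f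
  minimal f pid = Σᵥ-positive m (val {Edgeless m} f) λ v →
    positive-label (Edgeless m) f pid v (λ nb≡2 → 0≢2 (trans (sym (isolated f v)) nb≡2))
    where
    0≢2 : ¬ (0 ≡ 2)
    0≢2 ()

Star : ℕ → Graph
Star m = record { n = suc m ; adj = star-adj ; sym = star-sym ; irrefl = star-irrefl }
  where
  star-adj : Fin (suc m) → Fin (suc m) → Bool
  star-adj zero    zero    = false
  star-adj zero    (suc _) = true
  star-adj (suc _) zero    = true
  star-adj (suc _) (suc _) = false

  star-sym : ∀ u v → star-adj u v ≡ star-adj v u
  star-sym zero    zero    = refl
  star-sym zero    (suc _) = refl
  star-sym (suc _) zero    = refl
  star-sym (suc _) (suc _) = refl

  star-irrefl : ∀ v → star-adj v v ≡ false
  star-irrefl zero    = refl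
  star-irrefl (suc _) = refl

module _ (m : ℕ) (f : Labelling (Star m)) where
  leafSum : ℕ
  leafSum = Σᵥ m (val {Star m} f ∘ suc)

  star-weight : weight (Star m) f ≡ val {Star m} f zero + leafSum
  star-weight = Σᵥ-suc m (val {Star m} f)

  star-nb-centre : nbSum (Star m) f zero ≡ leafSum
  star-nb-centre = Σᵥ-suc m (λ u → if adj (Star m) zero u then val {Star m} f u else 0)

  star-nb-leaf : ∀ i → nbSum (Star m) f (suc i) ≡ val {Star m} f zero
  star-nb-leaf i = trans (Σᵥ-suc m _)
    (trans (cong (val {Star m} f zero +_) (Σᵥ-zero m _ (λ _ → refl))) (+-identityʳ _))

leaves-induced : ∀ m → IsInducedSubgraph (Edgeless m) (Star m)
leaves-induced m = suc , suc-injective , λ _ _ → refl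

-- Whatever the centre label, the centre and leaves together carry weight ≥ 2:
-- label 0 forces leafSum = 2, label 1 forces all (≥ 1) leaves positive.
star-lower-bound : ∀ m (f : Labelling (Star (suc m))) → IsPID (Star (suc m)) f →
  2 ≤ weight (Star (suc m)) f
star-lower-bound m f pid = subst (2 ≤_) (sym (star-weight (suc m) f)) (by-centre (f zero) refl)
  where
  S = Star (suc m)
  leaves = leafSum (suc m) f

  by-centre : ∀ c → f zero ≡ c → 2 ≤ toℕ c + leaves
  by-centre zero             fc = ≤-reflexive (trans (sym (pid zero (cong toℕ fc)))
                                                     (star-nb-centre (suc m) f))
  by-centre (suc zero)       fc = s≤s (≤-trans (s≤s z≤n)
    (Σᵥ-positive (suc m) _ λ i → positive-label S f pid (suc i) λ nb≡2 →
      1≢2 (trans (trans (sym (cong toℕ fc)) (sym (star-nb-leaf (suc m) f i))) nb≡2)))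
    where
    1≢2 : ¬ (1 ≡ 2)
    1≢2 ()
  by-centre (suc (suc zero)) fc = m≤m+n 2 leaves

Star-PIDNumber : ∀ m → PIDNumber (Star (suc m)) 2
Star-PIDNumber m = (centre-two , pid , weight-two) , star-lower-bound m
  where
  S = Star (suc m)

  centre-two : Labelling S
  centre-two zero    = suc (suc zero)
  centre-two (suc _) = zero

  pid : IsPID S centre-two
  pid zero    ()
  pid (suc i) _ = star-nb-leaf (suc m) centre-two i

  weight-two : weight S centre-two ≡ 2
  weight-two = trans (star-weight (suc m) centre-two)
                     (cong (2 +_) (Σᵥ-zero (suc m) _ (λ _ → refl)))

infixl 6 _⊕_
_⊕_ : Graph → Graph → Graph
G ⊕ H = record
  { n      = n G + n H
  ; adj    = λ u v → adj′ (splitAt (n G) u) (splitAt (n G) v)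
  ; sym    = λ u v → sym′ (splitAt (n G) u) (splitAt (n G) v)
  ; irrefl = λ v → irrefl′ (splitAt (n G) v)
  }
  where
  adj′ : Fin (n G) ⊎ Fin (n H) → Fin (n G) ⊎ Fin (n H) → Bool
  adj′ (inj₁ i) (inj₁ j) = adj G i j
  adj′ (inj₁ _) (inj₂ _) = false
  adj′ (inj₂ _) (inj₁ _) = false
  adj′ (inj₂ i) (inj₂ j) = adj H i j

  sym′ : ∀ x y → adj′ x y ≡ adj′ y x
  sym′ (inj₁ i) (inj₁ j) = Graph.sym G i j
  sym′ (inj₁ _) (inj₂ _) = refl
  sym′ (inj₂ _) (inj₁ _) = refl
  sym′ (inj₂ i) (inj₂ j) = Graph.sym H i j

  irrefl′ : ∀ x → adj′ x x ≡ false
  irrefl′ (inj₁ i) = irrefl G i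
  irrefl′ (inj₂ i) = irrefl H i

module _ (G H : Graph) where
  private
    inl : Fin (n G) → Fin (n G + n H)
    inl i = i ↑ˡ n H

    inr : Fin (n H) → Fin (n G + n H)
    inr j = n G ↑ʳ j

  ⊕-adj-ll : ∀ i j → adj (G ⊕ H) (inl i) (inl j) ≡ adj G i j
  ⊕-adj-ll i j rewrite splitAt-↑ˡ (n G) i (n H) | splitAt-↑ˡ (n G) j (n H) = refl

  ⊕-adj-lr : ∀ i j → adj (G ⊕ H) (inl i) (inr j) ≡ false
  ⊕-adj-lr i j rewrite splitAt-↑ˡ (n G) i (n H) | splitAt-↑ʳ (n G) (n H) j = refl

  ⊕-adj-rl : ∀ i j → adj (G ⊕ H) (inr i) (inl j) ≡ false
  ⊕-adj-rl i j rewrite splitAt-↑ʳ (n G) (n H) i | splitAt-↑ˡ (n G) j (n H) = refl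

  ⊕-adj-rr : ∀ i j → adj (G ⊕ H) (inr i) (inr j) ≡ adj H i j
  ⊕-adj-rr i j rewrite splitAt-↑ʳ (n G) (n H) i | splitAt-↑ʳ (n G) (n H) j = refl

  ⊕-inducedˡ : IsInducedSubgraph G (G ⊕ H)
  ⊕-inducedˡ = inl , (λ {i} {j} → ↑ˡ-injective (n H) i j) , ⊕-adj-ll

  module _ (F : Labelling (G ⊕ H)) where
    restrictˡ : Labelling G
    restrictˡ = F ∘ inl

    restrictʳ : Labelling H
    restrictʳ = F ∘ inr

    private
      masked : Fin (n G + n H) → Fin (n G + n H) → ℕ
      masked v u = if adj (G ⊕ H) v u then val {G ⊕ H} F u else 0

      vanish : ∀ {b} x → b ≡ false → (if b then x else 0) ≡ 0
      vanish x refl = refl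

      Balanced : Fin (n G + n H) → Set
      Balanced u = val {G ⊕ H} F u ≡ 0 → nbSum (G ⊕ H) F u ≡ 2

    -- A vertex only sees neighbours in its own component.
    ⊕-nbSumˡ : ∀ i → nbSum (G ⊕ H) F (inl i) ≡ nbSum G restrictˡ i
    ⊕-nbSumˡ i = trans (Σᵥ-split (n G) (n H) (masked (inl i)))
      (trans (cong₂ _+_
        (Σᵥ-cong (n G) λ j → cong (λ b → if b then val {G ⊕ H} F (inl j) else 0) (⊕-adj-ll i j))
        (Σᵥ-zero (n H) _ λ j → vanish _ (⊕-adj-lr i j)))
      (+-identityʳ _))

    ⊕-nbSumʳ : ∀ i → nbSum (G ⊕ H) F (inr i) ≡ nbSum H restrictʳ i
    ⊕-nbSumʳ i = trans (Σᵥ-split (n G) (n H) (masked (inr i)))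
      (cong₂ _+_
        (Σᵥ-zero (n G) _ λ j → vanish _ (⊕-adj-rl i j))
        (Σᵥ-cong (n H) λ j → cong (λ b → if b then val {G ⊕ H} F (inr j) else 0) (⊕-adj-rr i j)))

    ⊕-weight : weight (G ⊕ H) F ≡ weight G restrictˡ + weight H restrictʳ
    ⊕-weight = Σᵥ-split (n G) (n H) (val {G ⊕ H} F)

    ⊕-IsPID⇒ : IsPID (G ⊕ H) F → IsPID G restrictˡ × IsPID H restrictʳ
    ⊕-IsPID⇒ pid = (λ i z → trans (sym (⊕-nbSumˡ i)) (pid (inl i) z))
                 , (λ j z → trans (sym (⊕-nbSumʳ j)) (pid (inr j) z))

    ⊕-IsPID⇐ : IsPID G restrictˡ → IsPID H restrictʳ → IsPID (G ⊕ H) F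
    ⊕-IsPID⇐ pidˡ pidʳ v = by-block (splitAt (n G) v) refl
      where
      by-block : ∀ x → splitAt (n G) v ≡ x → Balanced v
      by-block (inj₁ i) split≡ =
        subst Balanced (splitAt⁻¹-↑ˡ split≡) λ z → trans (⊕-nbSumˡ i) (pidˡ i z)
      by-block (inj₂ j) split≡ =
        subst Balanced (splitAt⁻¹-↑ʳ split≡) λ z → trans (⊕-nbSumʳ j) (pidʳ j z)

  -- Optimal labellings of G and H combine; any PID-function of G ⊕ H
  -- restricts to PID-functions of G and H, whose weights add up.
  ⊕-PIDNumber : ∀ {a b} → PIDNumber G a → PIDNumber H b → PIDNumber (G ⊕ H) (a + b)
  ⊕-PIDNumber {a} {b} ((f , pid-f , wf) , min-G) ((g , pid-g , wg) , min-H) =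
    (f ++ g , pid , weight-sum) , minimal
    where
    left : restrictˡ (f ++ g) ≗ f
    left = lookup-++ˡ f g

    right : restrictʳ (f ++ g) ≗ g
    right = lookup-++ʳ f g

    pid : IsPID (G ⊕ H) (f ++ g)
    pid = ⊕-IsPID⇐ (f ++ g) (IsPID-cong G (sym ∘ left) pid-f) (IsPID-cong H (sym ∘ right) pid-g)

    weight-sum : weight (G ⊕ H) (f ++ g) ≡ a + b
    weight-sum = trans (⊕-weight (f ++ g))
      (cong₂ _+_ (trans (weight-cong G left) wf) (trans (weight-cong H right) wg))

    minimal : ∀ F → IsPID (G ⊕ H) F → a + b ≤ weight (G ⊕ H) F
    minimal F pid-F with ⊕-IsPID⇒ F pid-F
    ... | pidˡ , pidʳ = subst (a + b ≤_) (sym (⊕-weight F))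
                          (+-mono-≤ (min-G (restrictˡ F) pidˡ) (min-H (restrictʳ F) pidʳ))

-- G = K₁,b ⊕ Ē(a ∸ 2) has γᵖᴵ = 2 + (a ∸ 2) = a; its induced subgraph
-- H = Ē b (the leaves of the star) has γᵖᴵ = b.  The construction only
-- needs a ≥ 2 and b ≥ 1.
theorem3p1 : (a b : ℕ) → 3 ≤ a → 3 ≤ b →
    Σ Graph (λ G → Σ Graph (λ H →
      IsInducedSubgraph H G × PIDNumber G a × PIDNumber H b))
theorem3p1 0             _        ()       _
theorem3p1 1             _        (s≤s ()) _
theorem3p1 _             0        _        ()
theorem3p1 (suc (suc k)) (suc b′) _        _ =
  G , H , leaves⊆G ,
  ⊕-PIDNumber K (Edgeless k) (Star-PIDNumber b′) (Edgeless-PIDNumber k) ,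
  Edgeless-PIDNumber (suc b′)
  where
  K = Star (suc b′)
  G = K ⊕ Edgeless k
  H = Edgeless (suc b′)

  leaves⊆G : IsInducedSubgraph H G
  leaves⊆G = induced-trans {A = H} {B = K} {C = G} (leaves-induced (suc b′)) (⊕-inducedˡ K (Edgeless k))
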